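{- The generating functions $M_{\mathrm I}(x,y;t)$ and $M_{\mathrm{II}}(x,y;t)$ of Motzkin N-walks of type I and type II, as well as the generating function $M(x,y;t)=M_{\mathrm I}(x,y;t)+M_{\mathrm{II}}(x,y;t)$ of all Motzkin N-walks, are rational.
   Context: An N-step is a non-empty finite set of integers. Motzkin N-walks are finite sequences $w=(s_1,\dots,s_n)$ of N-steps from $S_M=\{\{ -1\},\{0\},\{1\},\{ -1,0\},\{ -1,1\},\{0,1\},\{ -1,0,1\}\}$, starting at $0$, $|w|=n$. The reachable points $\operatorname{reach}(w)$ are the endpoints $v_1+\dots+v_n$ of all integer sequences with $v_i\in s_i$; $\min(w),\max(w)$ are their minimum and maximum, and $\|w\|=\max(w)-\min(w)$. $w$ is of type I if $\operatorname{reach}(w)=\{\min(w)+i: i=0,\dots,\|w\|\}$ and $\|w\|\ge1$, and of type II if $\operatorname{reach}(w)=\{\min(w)+2i: i=0,\dots,\|w\|/2\}$. $M_{\mathrm I}(x,y;t)=\sum_w x^{\min(w)}y^{\max(w)}t^{|w|}$ over Motzkin N-walks of type I, and $M_{\mathrm{II}}$ likewise for type II. -}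

module Defs where

open import Data.Bool using (T?; Bool; true; false; _∧_; if_then_else_)
open import Data.Nat as ℕ using (ℕ; zero; suc; _≤ᵇ_)
open import Data.Integer as ℤ using (ℤ; +_; -[1+_]; _⊓_; _⊔_; _-_; ∣_∣)
open import Data.List using (List; []; _∷_; map; concatMap; filter; length; upTo; foldr)
open import Data.Bool.ListAction using (all; any)
open import Data.List.NonEmpty as L⁺ using (List⁺; _∷_; [_]; foldr₁)
open import Data.Product using (Σ; ∃; _×_; _,_)
open import Relation.Nullary using (¬_)
open import Relation.Nullary.Decidable using (⌊_⌋; does)
open import Relation.Binary.PropositionalEquality using (_≡_)

-- Motzkin N-steps: the seven non-empty subsets of {-1,0,1}

data Step : Set where
  sM sZ sP sMZ sMP sZP sMZP : Step

elems : Step → List ℤ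
elems sM   = -[1+ 0 ] ∷ []
elems sZ   = + 0 ∷ []
elems sP   = + 1 ∷ []
elems sMZ  = -[1+ 0 ] ∷ + 0 ∷ []
elems sMP  = -[1+ 0 ] ∷ + 1 ∷ []
elems sZP  = + 0 ∷ + 1 ∷ []
elems sMZP = -[1+ 0 ] ∷ + 0 ∷ + 1 ∷ []

allSteps : List Step
allSteps = sM ∷ sZ ∷ sP ∷ sMZ ∷ sMP ∷ sZP ∷ sMZP ∷ []

Walk : Set
Walk = List Step

walksOfLength : ℕ → List Walk
walksOfLength zero    = [] ∷ []
walksOfLength (suc n) = concatMap (λ s → map (s ∷_) (walksOfLength n)) allSteps

-- reachable points (as a non-empty list, duplicates allowed; set semantics)

reachL : Walk → List ℤ
reachL []      = + 0 ∷ []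
reachL (s ∷ w) = concatMap (λ v → map (λ z → v ℤ.+ z) (reachL w)) (elems s)

-- reachL is never empty; we package it as a non-empty list to take min/max
reach : Walk → List⁺ ℤ
reach w with reachL w
... | []     = [ + 0 ]   -- impossible case
... | z ∷ zs = z ∷ zs

minW : Walk → ℤ
minW w = foldr₁ _⊓_ (reach w)

maxW : Walk → ℤ
maxW w = foldr₁ _⊔_ (reach w)

normW : Walk → ℕ
normW w = ∣ maxW w - minW w ∣

_∈ᵇ_ : ℤ → List ℤ → Bool
z ∈ᵇ zs = any (λ u → ⌊ z ℤ.≟ u ⌋) zs

_≈ᵇ_ : List ℤ → List ℤ → Bool
xs ≈ᵇ ys = all (_∈ᵇ ys) xs ∧ all (_∈ᵇ xs) ys

setI : Walk → List ℤ
setI w = map (λ i → minW w ℤ.+ + i) (upTo (suc (normW w)))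

setII : Walk → List ℤ
setII w = map (λ i → minW w ℤ.+ + (2 ℕ.* i)) (upTo (suc (normW w ℕ./ 2)))

isTypeI : Walk → Bool
isTypeI w = (L⁺.toList (reach w) ≈ᵇ setI w) ∧ (1 ≤ᵇ normW w)

isTypeII : Walk → Bool
isTypeII w = L⁺.toList (reach w) ≈ᵇ setII w

-- Formal power series in t with Laurent-polynomial coefficients in x,y:
-- a series is given by its coefficient function  F n a b = [t^n x^a y^b] F.

Series : Set
Series = ℕ → ℤ → ℤ → ℤ

countWalks : (Walk → Bool) → ℕ → ℤ → ℤ → ℕ
countWalks P n a b =
  length (filter (λ w → T? (P w ∧ ⌊ minW w ℤ.≟ a ⌋ ∧ ⌊ maxW w ℤ.≟ b ⌋))
                 (walksOfLength n))

M-I : Series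
M-I n a b = + countWalks isTypeI n a b

M-II : Series
M-II n a b = + countWalks isTypeII n a b

M : Series
M n a b = M-I n a b ℤ.+ M-II n a b

-- Laurent polynomials in x, y and polynomials in t, with integer
-- coefficients, given as finite lists of terms (k , c , d , q) = q t^k x^c y^d.

Poly : Set
Poly = List (ℕ × ℤ × ℤ × ℤ)

coeff : Poly → Series
coeff P n a b =
  foldr (λ { (k , c , d , q) acc →
              (if ⌊ k ℕ.≟ n ⌋ ∧ ⌊ c ℤ.≟ a ⌋ ∧ ⌊ d ℤ.≟ b ⌋ then q else + 0) ℤ.+ acc })
        (+ 0) P

_⊛_ : Poly → Series → Series
(Q ⊛ F) n a b =
  foldr (λ { (k , c , d , q) acc →
              (if k ≤ᵇ n then q ℤ.* F (n ℕ.∸ k) (a - c) (b - d) else + 0) ℤ.+ acc })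
        (+ 0) Q

-- F is rational: F = P / Q for polynomials P, Q with Q ≠ 0
IsRational : Series → Set
IsRational F =
  Σ Poly λ P → Σ Poly λ Q →
    (∃ λ n → ∃ λ a → ∃ λ b → ¬ (coeff Q n a b ≡ + 0)) ×
    (∀ n a b → (Q ⊛ F) n a b ≡ coeff P n a b)

module Submission where

-- The weight x^min(w) y^max(w) t^|w| of a Motzkin N-walk is multiplicative in its steps.
-- Indeed, write a step s as min s + P(s) with P(s) one of {0}, {0,1}, {0,2}, {0,1,2}. By
-- induction on the walk, reach(w) − Σ min sᵢ is the "profile" {d ≤ D : K or d even}, where
-- D = Σ (max sᵢ − min sᵢ) and K says that some step contains two consecutive integers (if K
-- then D ≥ 1, otherwise D is even). Hence min(w) = Σ min sᵢ, max(w) = Σ max sᵢ, and w is of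
-- type I iff K, of type II iff not K. Consequently M = 1/Q₁ and M_II = 1/Q₂, with
-- Q₁ = 1 − t Σ_s x^{min s} y^{max s} over all seven steps and Q₂ the same sum restricted to
-- the steps without consecutive integers, so M_I = M − M_II = (Q₂ − Q₁)/(Q₁ Q₂).

open import Defs
open import Data.Bool using (Bool; true; false; _∧_; _∨_; not; if_then_else_; T)
open import Data.Bool.Properties
  using (∨-identityʳ; ∧-zeroʳ; ∨-assoc; ∧-assoc; T-∨; T-∧; T-≡)
open import Data.Bool.ListAction using (all; any)
open import Data.Empty using (⊥-elim)
open import Data.Integer as ℤ using (ℤ; +_; -[1+_]; _-_; _⊓_; _⊔_; +≤+)
import Data.Integer.Properties as ℤP
open import Data.Integer.Tactic.RingSolver using (solve-∀)
open import Data.List using (List; []; _∷_; map; concatMap; _++_; upTo; length; filterᵇ)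
import Data.List.Properties as LP
open import Data.List.NonEmpty as L⁺ using (List⁺; _∷_; foldr₁)
open import Data.Nat as ℕ using (ℕ; zero; suc; _≤ᵇ_; _<ᵇ_; _≡ᵇ_; z≤n; _∸_)
import Data.Nat.Properties as ℕP
open import Data.Nat.Divisibility using (_∣_; _∣0; ∣m∣n⇒∣m+n; ∣-refl)
open import Data.Nat.DivMod using (m/n*n≡m)
open import Data.Nat.ListAction using (sum)
open import Data.Product using (_×_; _,_; proj₁; proj₂)
open import Data.Sum using (inj₂)
open import Data.Unit using (tt)
open import Function using (_∘_; id)
open import Function.Bundles using (mk⇔; Equivalence)
open import Relation.Nullary using (Dec; yes; no)
open import Relation.Nullary.Decidable using (⌊_⌋; isYes≗does; does-⇔; T?)
open import Relation.Nullary.Reflects using (ofʸ; ofⁿ)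
open import Relation.Binary.PropositionalEquality

i+j-i≡j : ∀ i j → i ℤ.+ j - i ≡ j
i+j-i≡j = solve-∀

i≡j+[i-j] : ∀ i j → i ≡ j ℤ.+ (i - j)
i≡j+[i-j] = solve-∀

i-j-k≡i-[j+k] : ∀ i j k → i - j - k ≡ i - (j ℤ.+ k)
i-j-k≡i-[j+k] = solve-∀

⌊⌋-⇔ : {A B : Set} → (A → B) → (B → A) → (a? : Dec A) (b? : Dec B) → ⌊ a? ⌋ ≡ ⌊ b? ⌋
⌊⌋-⇔ f g a? b? =
  trans (isYes≗does a?) (trans (does-⇔ (mk⇔ f g) a? b?) (sym (isYes≗does b?)))

≟-sym : ∀ (x y : ℤ) → ⌊ x ℤ.≟ y ⌋ ≡ ⌊ y ℤ.≟ x ⌋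
≟-sym x y = ⌊⌋-⇔ sym sym (x ℤ.≟ y) (y ℤ.≟ x)

≟-+ʳ : ∀ z v y → ⌊ z ℤ.≟ v ℤ.+ y ⌋ ≡ ⌊ z - v ℤ.≟ y ⌋
≟-+ʳ z v y = ⌊⌋-⇔ (λ { refl → i+j-i≡j v y }) (λ { refl → i≡j+[i-j] z v })
                  (z ℤ.≟ v ℤ.+ y) (z - v ℤ.≟ y)

≟-+ˡ : ∀ m x a → ⌊ m ℤ.+ x ℤ.≟ a ⌋ ≡ ⌊ x ℤ.≟ a - m ⌋
≟-+ˡ m x a = trans (≟-sym (m ℤ.+ x) a) (trans (≟-+ʳ a m x) (≟-sym (a - m) x))

∨-≡ʳ : ∀ {a b} → (T a → T b) → a ∨ b ≡ b
∨-≡ʳ {false}        _   = refl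
∨-≡ʳ {true} {true}  _   = refl
∨-≡ʳ {true} {false} a⇒b = ⊥-elim (a⇒b tt)

∨-spread : ∀ a b c → a ∨ (b ∨ (c ∨ false)) ≡ (a ∨ b) ∨ (b ∨ c)
∨-spread true  b     c = refl
∨-spread false true  c = refl
∨-spread false false c = ∨-identityʳ c

not-∨ : ∀ a b → not (a ∨ b) ≡ not a ∧ not b
not-∨ true  b = refl
not-∨ false b = refl

any-cong : ∀ {A : Set} {p q : A → Bool} → (∀ x → p x ≡ q x) → ∀ xs → any p xs ≡ any q xs
any-cong p≗q []       = refl
any-cong p≗q (x ∷ xs) = cong₂ _∨_ (p≗q x) (any-cong p≗q xs)

any-++ : ∀ {A : Set} (p : A → Bool) xs ys → any p (xs ++ ys) ≡ any p xs ∨ any p ys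
any-++ p []       ys = refl
any-++ p (x ∷ xs) ys = trans (cong (p x ∨_) (any-++ p xs ys)) (sym (∨-assoc (p x) _ _))

any-≡false : ∀ {A : Set} (p : A → Bool) xs → (∀ x → p x ≡ false) → any p xs ≡ false
any-≡false p []       _   = refl
any-≡false p (x ∷ xs) p≡f rewrite p≡f x = any-≡false p xs p≡f

∈ᵇ-here : ∀ x xs → T (x ∈ᵇ (x ∷ xs))
∈ᵇ-here x xs with x ℤ.≟ x
... | yes _  = tt
... | no x≢x = ⊥-elim (x≢x refl)

∈ᵇ-there : ∀ z x xs → T (z ∈ᵇ xs) → T (z ∈ᵇ (x ∷ xs))
∈ᵇ-there z x xs z∈xs = Equivalence.from T-∨ (inj₂ z∈xs)

∈ᵇ-map-+ : ∀ {A : Set} z v (f : A → ℤ) xs →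
           z ∈ᵇ map (λ x → v ℤ.+ f x) xs ≡ any (λ x → ⌊ z - v ℤ.≟ f x ⌋) xs
∈ᵇ-map-+ z v f []       = refl
∈ᵇ-map-+ z v f (x ∷ xs) = cong₂ _∨_ (≟-+ʳ z v (f x)) (∈ᵇ-map-+ z v f xs)

∈ᵇ-concatMap-+ : ∀ z vs ys →
                 z ∈ᵇ concatMap (λ v → map (λ y → v ℤ.+ y) ys) vs ≡ any (λ v → (z - v) ∈ᵇ ys) vs
∈ᵇ-concatMap-+ z []       ys = refl
∈ᵇ-concatMap-+ z (v ∷ vs) ys =
  trans (any-++ (λ u → ⌊ z ℤ.≟ u ⌋) (map (λ y → v ℤ.+ y) ys) _)
        (cong₂ _∨_ (∈ᵇ-map-+ z v id ys) (∈ᵇ-concatMap-+ z vs ys))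

all-≡true : ∀ (p : ℤ → Bool) xs → (∀ z → T (z ∈ᵇ xs) → p z ≡ true) → all p xs ≡ true
all-≡true p []       _ = refl
all-≡true p (x ∷ xs) h rewrite h x (∈ᵇ-here x xs) =
  all-≡true p xs (λ z → h z ∘ ∈ᵇ-there z x xs)

all-≡false : ∀ (p : ℤ → Bool) xs z → T (z ∈ᵇ xs) → p z ≡ false → all p xs ≡ false
all-≡false p (x ∷ xs) z z∈ pz with z ℤ.≟ x
... | yes refl rewrite pz = refl
... | no _     = trans (cong (p x ∧_) (all-≡false p xs z z∈ pz)) (∧-zeroʳ (p x))

≈ᵇ-≡true : ∀ xs ys → (∀ z → z ∈ᵇ xs ≡ z ∈ᵇ ys) → xs ≈ᵇ ys ≡ true
≈ᵇ-≡true xs ys same =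
  cong₂ _∧_ (all-≡true _ xs (λ z p → trans (sym (same z)) (Equivalence.to T-≡ p)))
            (all-≡true _ ys (λ z p → trans (same z) (Equivalence.to T-≡ p)))

≈ᵇ-≡falseˡ : ∀ xs ys z → T (z ∈ᵇ xs) → z ∈ᵇ ys ≡ false → xs ≈ᵇ ys ≡ false
≈ᵇ-≡falseˡ xs ys z z∈xs z∉ys = cong (_∧ all (_∈ᵇ xs) ys) (all-≡false _ xs z z∈xs z∉ys)

≈ᵇ-≡falseʳ : ∀ xs ys z → T (z ∈ᵇ ys) → z ∈ᵇ xs ≡ false → xs ≈ᵇ ys ≡ false
≈ᵇ-≡falseʳ xs ys z z∈ys z∉xs =
  trans (cong (all (_∈ᵇ ys) xs ∧_) (all-≡false _ ys z z∈ys z∉xs)) (∧-zeroʳ _)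

foldr₁-⊓-≤ : ∀ x xs z → T (z ∈ᵇ (x ∷ xs)) → foldr₁ _⊓_ (x ∷ xs) ℤ.≤ z
foldr₁-⊓-≤ x xs z p with z ℤ.≟ x | xs
... | yes refl | []     = ℤP.≤-refl
... | yes refl | y ∷ ys = ℤP.i⊓j≤i z _
... | no _     | y ∷ ys = ℤP.≤-trans (ℤP.i⊓j≤j x _) (foldr₁-⊓-≤ y ys z p)

foldr₁-⊓-glb : ∀ x xs m → (∀ z → T (z ∈ᵇ (x ∷ xs)) → m ℤ.≤ z) → m ℤ.≤ foldr₁ _⊓_ (x ∷ xs)
foldr₁-⊓-glb x []       m m≤ = m≤ x (∈ᵇ-here x [])
foldr₁-⊓-glb x (y ∷ ys) m m≤ =
  ℤP.⊓-glb (m≤ x (∈ᵇ-here x (y ∷ ys)))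
           (foldr₁-⊓-glb y ys m (λ z p → m≤ z (∈ᵇ-there z x (y ∷ ys) p)))

foldr₁-⊔-≥ : ∀ x xs z → T (z ∈ᵇ (x ∷ xs)) → z ℤ.≤ foldr₁ _⊔_ (x ∷ xs)
foldr₁-⊔-≥ x xs z p with z ℤ.≟ x | xs
... | yes refl | []     = ℤP.≤-refl
... | yes refl | y ∷ ys = ℤP.i≤i⊔j z _
... | no _     | y ∷ ys = ℤP.≤-trans (foldr₁-⊔-≥ y ys z p) (ℤP.i≤j⊔i x _)

foldr₁-⊔-lub : ∀ x xs m → (∀ z → T (z ∈ᵇ (x ∷ xs)) → z ℤ.≤ m) → foldr₁ _⊔_ (x ∷ xs) ℤ.≤ m
foldr₁-⊔-lub x []       m ≤m = ≤m x (∈ᵇ-here x [])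
foldr₁-⊔-lub x (y ∷ ys) m ≤m =
  ℤP.⊔-lub (≤m x (∈ᵇ-here x (y ∷ ys)))
           (foldr₁-⊔-lub y ys m (λ z p → ≤m z (∈ᵇ-there z x (y ∷ ys) p)))

foldr₁-⊓-≡ : ∀ (L : List⁺ ℤ) m → T (m ∈ᵇ L⁺.toList L) →
             (∀ z → T (z ∈ᵇ L⁺.toList L) → m ℤ.≤ z) → foldr₁ _⊓_ L ≡ m
foldr₁-⊓-≡ (x ∷ xs) m m∈ m≤ = ℤP.≤-antisym (foldr₁-⊓-≤ x xs m m∈) (foldr₁-⊓-glb x xs m m≤)

foldr₁-⊔-≡ : ∀ (L : List⁺ ℤ) m → T (m ∈ᵇ L⁺.toList L) →
             (∀ z → T (z ∈ᵇ L⁺.toList L) → z ℤ.≤ m) → foldr₁ _⊔_ L ≡ m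
foldr₁-⊔-≡ (x ∷ xs) m m∈ ≤m = ℤP.≤-antisym (foldr₁-⊔-lub x xs m ≤m) (foldr₁-⊔-≥ x xs m m∈)

<ᵇ-pred : ∀ d D → T (suc d <ᵇ D) → T (d <ᵇ D)
<ᵇ-pred zero    (suc D) _ = tt
<ᵇ-pred (suc d) (suc D) p = <ᵇ-pred d D p

<ᵇ-∨-≡ᵇ : ∀ d n → (d <ᵇ n) ∨ ((d ≡ᵇ n) ∨ false) ≡ (d <ᵇ suc n)
<ᵇ-∨-≡ᵇ zero    zero    = refl
<ᵇ-∨-≡ᵇ zero    (suc n) = refl
<ᵇ-∨-≡ᵇ (suc d) zero    = refl
<ᵇ-∨-≡ᵇ (suc d) (suc n) = <ᵇ-∨-≡ᵇ d n

even : ℕ → Bool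
even zero          = true
even (suc zero)    = false
even (suc (suc n)) = even n

even-double : ∀ h → T (even (2 ℕ.* h))
even-double zero    = tt
even-double (suc h) rewrite ℕP.*-suc 2 h = even-double h

even⇒2∣ : ∀ D → T (even D) → 2 ∣ D
even⇒2∣ zero          _ = 2 ∣0
even⇒2∣ (suc (suc D)) e = ∣m∣n⇒∣m+n (∣-refl {2}) (even⇒2∣ D e)

double-half : ∀ D → T (even D) → 2 ℕ.* (D ℕ./ 2) ≡ D
double-half D e = trans (ℕP.*-comm 2 (D ℕ./ 2)) (m/n*n≡m (even⇒2∣ D e))

even-<ᵇ-∨-≡ᵇ : ∀ e d → T (even e) →
               even d ∧ (d <ᵇ suc e) ∨ ((d ≡ᵇ 2 ℕ.+ e) ∨ false) ≡ even d ∧ (d <ᵇ 3 ℕ.+ e)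
even-<ᵇ-∨-≡ᵇ zero          zero                _ = refl
even-<ᵇ-∨-≡ᵇ zero          (suc zero)          _ = refl
even-<ᵇ-∨-≡ᵇ zero          (suc (suc zero))    _ = refl
even-<ᵇ-∨-≡ᵇ zero          (suc (suc (suc d))) _ rewrite ∧-zeroʳ (even (suc d)) = refl
even-<ᵇ-∨-≡ᵇ (suc (suc e)) zero                _ = refl
even-<ᵇ-∨-≡ᵇ (suc (suc e)) (suc zero)          _ = refl
even-<ᵇ-∨-≡ᵇ (suc (suc e)) (suc (suc d))       x = even-<ᵇ-∨-≡ᵇ e d x

any-upTo-suc : ∀ (p : ℕ → Bool) n → any p (upTo (suc n)) ≡ any p (upTo n) ∨ (p n ∨ false)
any-upTo-suc p n =
  trans (cong (any p) (sym (LP.applyUpTo-∷ʳ id n))) (any-++ p (upTo n) (n ∷ []))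

any-≡ᵇ-upTo : ∀ D d → any (d ≡ᵇ_) (upTo (suc D)) ≡ (d <ᵇ suc D)
any-≡ᵇ-upTo zero    zero    = refl
any-≡ᵇ-upTo zero    (suc d) = refl
any-≡ᵇ-upTo (suc D) d =
  trans (any-upTo-suc (d ≡ᵇ_) (suc D))
        (trans (cong (_∨ ((d ≡ᵇ suc D) ∨ false)) (any-≡ᵇ-upTo D d)) (<ᵇ-∨-≡ᵇ d (suc D)))

any-≡ᵇ-upTo-double : ∀ h d →
                     any (λ i → d ≡ᵇ 2 ℕ.* i) (upTo (suc h)) ≡ even d ∧ (d <ᵇ suc (2 ℕ.* h))
any-≡ᵇ-upTo-double zero    zero    = refl
any-≡ᵇ-upTo-double zero    (suc d) = sym (∧-zeroʳ (even (suc d)))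
any-≡ᵇ-upTo-double (suc h) d
  rewrite any-upTo-suc (λ i → d ≡ᵇ 2 ℕ.* i) (suc h) | any-≡ᵇ-upTo-double h d | ℕP.*-suc 2 h
  = even-<ᵇ-∨-≡ᵇ (2 ℕ.* h) d (even-double h)

-- Reach profiles

-- The bound is written d <ᵇ suc D because suc m ≤ᵇ suc n does not reduce to m ≤ᵇ n for an
-- open m, whereas suc m <ᵇ suc n reduces to m <ᵇ n.
profile : Bool → ℕ → ℕ → Bool
profile K D d = (K ∨ even d) ∧ (d <ᵇ suc D)

Admissible : Bool → ℕ → Set
Admissible true  D = T (1 ≤ᵇ D)
Admissible false D = T (even D)

shift : (ℕ → Bool) → ℕ → Bool
shift f zero    = false
shift f (suc d) = f d

profile-widen₁ : ∀ K D → Admissible K D →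
                 ∀ d → profile K D d ∨ shift (profile K D) d ≡ profile true (suc D) d
profile-widen₁ true  D             _ zero             = refl
profile-widen₁ true  D             _ (suc d)          = ∨-≡ʳ (<ᵇ-pred d (suc D))
profile-widen₁ false D             _ zero             = refl
profile-widen₁ false D             _ (suc zero)       = refl
profile-widen₁ false zero          _ (suc (suc e))
  rewrite ∧-zeroʳ (even e) | ∧-zeroʳ (even (suc e)) = refl
profile-widen₁ false (suc (suc D)) _ (suc (suc zero)) = refl
profile-widen₁ false (suc (suc D)) x (suc (suc (suc e))) = profile-widen₁ false D x (suc e)

profile-widen₂ : ∀ K D → Admissible K D →
                 ∀ d → profile K D d ∨ shift (shift (profile K D)) d ≡ profile K (2 ℕ.+ D) d
profile-widen₂ true  D             _ zero          = refl
profile-widen₂ true  (suc D)       _ (suc zero)    = refl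
profile-widen₂ true  D             _ (suc (suc d)) =
  ∨-≡ʳ (<ᵇ-pred d (suc D) ∘ <ᵇ-pred (suc d) (suc D))
profile-widen₂ false D             _ zero          = refl
profile-widen₂ false D             _ (suc zero)    = refl
profile-widen₂ false zero          _ (suc (suc e)) rewrite ∧-zeroʳ (even e) = refl
profile-widen₂ false (suc (suc D)) _ (suc (suc zero))        = refl
profile-widen₂ false (suc (suc D)) _ (suc (suc (suc zero)))  = refl
profile-widen₂ false (suc (suc D)) x (suc (suc (suc (suc e)))) =
  profile-widen₂ false D x (suc (suc e))

-- {0,1,2} = {0,1} + {0,1}
profile-widen₁₂ : ∀ K D → Admissible K D → ∀ d →
                  profile K D d ∨ (shift (profile K D) d ∨ (shift (shift (profile K D)) d ∨ false))
                  ≡ profile true (2 ℕ.+ D) d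
profile-widen₁₂ K D x d = begin
  f d ∨ (shift f d ∨ (shift (shift f) d ∨ false))      ≡⟨ ∨-spread (f d) (shift f d) _ ⟩
  (f d ∨ shift f d) ∨ (shift f d ∨ shift (shift f) d)  ≡⟨ cong₂ _∨_ (profile-widen₁ K D x d)
                                                                     (shifted-widen₁ d) ⟩
  g d ∨ shift g d                                      ≡⟨ profile-widen₁ true (suc D) tt d ⟩
  profile true (2 ℕ.+ D) d                             ∎
  where
  open ≡-Reasoning
  f g : ℕ → Bool
  f = profile K D
  g = profile true (suc D)
  shifted-widen₁ : ∀ d → shift f d ∨ shift (shift f) d ≡ shift g d
  shifted-widen₁ zero    = refl
  shifted-widen₁ (suc d) = profile-widen₁ K D x d

profile-origin : ∀ K D → T (profile K D 0)
profile-origin true  D = tt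
profile-origin false D = tt

profile-top : ∀ K D → Admissible K D → T (profile K D D)
profile-top K D x = Equivalence.from T-∧ (K∨even K x , ℕP.<⇒<ᵇ (ℕP.n<1+n D))
  where
  K∨even : ∀ K → Admissible K D → T (K ∨ even D)
  K∨even true  _ = tt
  K∨even false x = x

profileℤ : Bool → ℕ → ℤ → Bool
profileℤ K D (+ d)    = profile K D d
profileℤ K D -[1+ _ ] = false

profileℤ-+0 : ∀ K D u → profileℤ K D (u ℤ.+ + 0) ≡ profileℤ K D u
profileℤ-+0 K D u = cong (profileℤ K D) (ℤP.+-identityʳ u)

profileℤ-1 : ∀ K D d → profileℤ K D (+ d ℤ.+ -[1+ 0 ]) ≡ shift (profile K D) d
profileℤ-1 K D zero    = refl
profileℤ-1 K D (suc d) = refl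

profileℤ-2 : ∀ K D d → profileℤ K D (+ d ℤ.+ -[1+ 1 ]) ≡ shift (shift (profile K D)) d
profileℤ-2 K D zero          = refl
profileℤ-2 K D (suc zero)    = refl
profileℤ-2 K D (suc (suc d)) = refl

profileℤ-range : ∀ K D u → T (profileℤ K D u) → + 0 ℤ.≤ u × u ℤ.≤ + D
profileℤ-range K D (+ d) p =
  +≤+ z≤n , +≤+ (ℕP.≤-pred (ℕP.<ᵇ⇒< d (suc D) (proj₂ (Equivalence.to T-∧ p))))

profileℤ-bounds : ∀ K D m z → T (profileℤ K D (z - m)) → m ℤ.≤ z × z ℤ.≤ m ℤ.+ + D
profileℤ-bounds K D m z p with profileℤ-range K D (z - m) p
... | 0≤u , u≤D =
  ℤP.0≤i-j⇒j≤i 0≤u , ℤP.≤-trans (ℤP.≤-reflexive (i≡j+[i-j] z m)) (ℤP.+-monoʳ-≤ m u≤D)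

profileℤ-at-min : ∀ K D m → T (profileℤ K D (m - m))
profileℤ-at-min K D m = subst (T ∘ profileℤ K D) (sym (ℤP.+-inverseʳ m)) (profile-origin K D)

profileℤ-at-max : ∀ K D m → Admissible K D → T (profileℤ K D (m ℤ.+ + D - m))
profileℤ-at-max K D m x = subst (T ∘ profileℤ K D) (sym (i+j-i≡j m (+ D))) (profile-top K D x)

interval : ℤ → ℕ → List ℤ
interval m D = map (λ i → m ℤ.+ + i) (upTo (suc D))

evenInterval : ℤ → ℕ → List ℤ
evenInterval m h = map (λ i → m ℤ.+ + (2 ℕ.* i)) (upTo (suc h))

∈ᵇ-interval : ∀ m D z → z ∈ᵇ interval m D ≡ profileℤ true D (z - m)
∈ᵇ-interval m D z = trans (∈ᵇ-map-+ z m +_ (upTo (suc D))) (any-upTo (z - m))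
  where
  any-upTo : ∀ u → any (λ i → ⌊ u ℤ.≟ + i ⌋) (upTo (suc D)) ≡ profileℤ true D u
  any-upTo (+ d)    = trans (any-cong (λ i → isYes≗does (+ d ℤ.≟ + i)) (upTo (suc D)))
                            (any-≡ᵇ-upTo D d)
  any-upTo -[1+ _ ] = any-≡false _ (upTo (suc D)) (λ _ → refl)

∈ᵇ-evenInterval : ∀ m h z → z ∈ᵇ evenInterval m h ≡ profileℤ false (2 ℕ.* h) (z - m)
∈ᵇ-evenInterval m h z =
  trans (∈ᵇ-map-+ z m (λ i → + (2 ℕ.* i)) (upTo (suc h))) (any-upTo (z - m))
  where
  any-upTo : ∀ u → any (λ i → ⌊ u ℤ.≟ + (2 ℕ.* i) ⌋) (upTo (suc h)) ≡ profileℤ false (2 ℕ.* h) u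
  any-upTo (+ d)    = trans (any-cong (λ i → isYes≗does (+ d ℤ.≟ + (2 ℕ.* i))) (upTo (suc h)))
                            (any-≡ᵇ-upTo-double h d)
  any-upTo -[1+ _ ] = any-≡false _ (upTo (suc h)) (λ _ → refl)

-- In both lemmas the point m + 1 separates the two shapes.
typeI-of-profile : ∀ R K D m → (∀ z → z ∈ᵇ R ≡ profileℤ K D (z - m)) → Admissible K D →
                   (R ≈ᵇ interval m D) ∧ (1 ≤ᵇ D) ≡ K
typeI-of-profile R true  (suc D) m R≡ _ =
  cong (_∧ true) (≈ᵇ-≡true R (interval m (suc D)) (λ z → trans (R≡ z) (sym (∈ᵇ-interval m (suc D) z))))
typeI-of-profile R false zero    m R≡ _ = ∧-zeroʳ _
typeI-of-profile R false (suc D) m R≡ _ = cong (_∧ true) (≈ᵇ-≡falseʳ R (interval m (suc D)) (m ℤ.+ + 1)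
  (subst T (sym (trans (∈ᵇ-interval m (suc D) (m ℤ.+ + 1))
                       (cong (profileℤ true (suc D)) (i+j-i≡j m (+ 1))))) tt)
  (trans (R≡ (m ℤ.+ + 1)) (cong (profileℤ false (suc D)) (i+j-i≡j m (+ 1)))))

typeII-of-profile : ∀ R K D m → (∀ z → z ∈ᵇ R ≡ profileℤ K D (z - m)) → Admissible K D →
                    R ≈ᵇ evenInterval m (D ℕ./ 2) ≡ not K
typeII-of-profile R false D m R≡ x = ≈ᵇ-≡true R (evenInterval m (D ℕ./ 2)) λ z → begin
  z ∈ᵇ R                                    ≡⟨ R≡ z ⟩
  profileℤ false D (z - m)                  ≡⟨ cong (λ e → profileℤ false e (z - m)) (double-half D x) ⟨
  profileℤ false (2 ℕ.* (D ℕ./ 2)) (z - m)  ≡⟨ ∈ᵇ-evenInterval m (D ℕ./ 2) z ⟨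
  z ∈ᵇ evenInterval m (D ℕ./ 2)             ∎
  where open ≡-Reasoning
typeII-of-profile R true  D m R≡ x = ≈ᵇ-≡falseˡ R (evenInterval m (D ℕ./ 2)) (m ℤ.+ + 1)
  (subst T (sym (trans (R≡ (m ℤ.+ + 1)) (cong (profileℤ true D) (i+j-i≡j m (+ 1))))) x)
  (trans (∈ᵇ-evenInterval m (D ℕ./ 2) (m ℤ.+ + 1)) (cong (profileℤ false _) (i+j-i≡j m (+ 1))))

-- Reach sets of walks

minStep : Step → ℤ
minStep sM   = -[1+ 0 ]
minStep sZ   = + 0
minStep sP   = + 1
minStep sMZ  = -[1+ 0 ]
minStep sMP  = -[1+ 0 ]
minStep sZP  = + 0
minStep sMZP = -[1+ 0 ]

widthStep : Step → ℕ
widthStep sMZ  = 1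
widthStep sZP  = 1
widthStep sMP  = 2
widthStep sMZP = 2
widthStep _    = 0

maxStep : Step → ℤ
maxStep s = minStep s ℤ.+ + widthStep s

hasConsecutive : Step → Bool
hasConsecutive sMZ  = true
hasConsecutive sZP  = true
hasConsecutive sMZP = true
hasConsecutive _    = false

minSum : Walk → ℤ
minSum []      = + 0
minSum (s ∷ w) = minStep s ℤ.+ minSum w

width : Walk → ℕ
width []      = 0
width (s ∷ w) = widthStep s ℕ.+ width w

maxSum : Walk → ℤ
maxSum w = minSum w ℤ.+ + width w

anyConsecutive : Walk → Bool
anyConsecutive []      = false
anyConsecutive (s ∷ w) = hasConsecutive s ∨ anyConsecutive w

admissible-step : ∀ s K D → Admissible K D →
                  Admissible (hasConsecutive s ∨ K) (widthStep s ℕ.+ D)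
admissible-step sM   K     D x = x
admissible-step sZ   K     D x = x
admissible-step sP   K     D x = x
admissible-step sMZ  K     D x = tt
admissible-step sZP  K     D x = tt
admissible-step sMZP K     D x = tt
admissible-step sMP  true  D x = tt
admissible-step sMP  false D x = x

admissible : ∀ w → Admissible (anyConsecutive w) (width w)
admissible []      = tt
admissible (s ∷ w) = admissible-step s _ _ (admissible w)

profile-step : ∀ s K D → Admissible K D → ∀ u →
               any (λ v → profileℤ K D (u ℤ.+ (minStep s - v))) (elems s)
               ≡ profileℤ (hasConsecutive s ∨ K) (widthStep s ℕ.+ D) u
profile-step sM   K D _ u        = trans (∨-identityʳ _) (profileℤ-+0 K D u)
profile-step sZ   K D _ u        = trans (∨-identityʳ _) (profileℤ-+0 K D u)
profile-step sP   K D _ u        = trans (∨-identityʳ _) (profileℤ-+0 K D u)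
profile-step sMZ  K D _ -[1+ _ ] = refl
profile-step sZP  K D _ -[1+ _ ] = refl
profile-step sMP  K D _ -[1+ _ ] = refl
profile-step sMZP K D _ -[1+ _ ] = refl
profile-step sMZ  K D x (+ d) =
  trans (cong₂ _∨_ (profileℤ-+0 K D (+ d)) (trans (∨-identityʳ _) (profileℤ-1 K D d)))
        (profile-widen₁ K D x d)
profile-step sZP  K D x (+ d) =
  trans (cong₂ _∨_ (profileℤ-+0 K D (+ d)) (trans (∨-identityʳ _) (profileℤ-1 K D d)))
        (profile-widen₁ K D x d)
profile-step sMP  K D x (+ d) =
  trans (cong₂ _∨_ (profileℤ-+0 K D (+ d)) (trans (∨-identityʳ _) (profileℤ-2 K D d)))
        (profile-widen₂ K D x d)
profile-step sMZP K D x (+ d) =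
  trans (cong₂ _∨_ (profileℤ-+0 K D (+ d))
                   (cong₂ (λ y z → y ∨ (z ∨ false)) (profileℤ-1 K D d) (profileℤ-2 K D d)))
        (profile-widen₁₂ K D x d)

∈ᵇ-reachL : ∀ w z → z ∈ᵇ reachL w ≡ profileℤ (anyConsecutive w) (width w) (z - minSum w)
∈ᵇ-reachL [] z = trans (origin z) (sym (profileℤ-+0 false 0 z))
  where
  origin : ∀ z → z ∈ᵇ (+ 0 ∷ []) ≡ profileℤ false 0 z
  origin (+ zero)  = refl
  origin (+ suc d) = sym (∧-zeroʳ (even (suc d)))
  origin -[1+ _ ]  = refl
∈ᵇ-reachL (s ∷ w) z = begin
  z ∈ᵇ reachL (s ∷ w)                                         ≡⟨ ∈ᵇ-concatMap-+ z (elems s) (reachL w) ⟩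
  any (λ v → (z - v) ∈ᵇ reachL w) (elems s)                   ≡⟨ any-cong recentre (elems s) ⟩
  any (λ v → profileℤ K D (u ℤ.+ (minStep s - v))) (elems s)  ≡⟨ profile-step s K D (admissible w) u ⟩
  profileℤ (hasConsecutive s ∨ K) (widthStep s ℕ.+ D) u       ∎
  where
  open ≡-Reasoning
  K = anyConsecutive w
  D = width w
  u = z - minSum (s ∷ w)
  regroup : ∀ z v m m₀ → z - v - m ≡ (z - (m₀ ℤ.+ m)) ℤ.+ (m₀ - v)
  regroup = solve-∀
  recentre : ∀ v → (z - v) ∈ᵇ reachL w ≡ profileℤ K D (u ℤ.+ (minStep s - v))
  recentre v =
    trans (∈ᵇ-reachL w (z - v)) (cong (profileℤ K D) (regroup z v (minSum w) (minStep s)))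

toList-reach : ∀ w → L⁺.toList (reach w) ≡ reachL w
toList-reach w with reachL w | subst T (sym (∈ᵇ-reachL w (minSum w))) (profileℤ-at-min _ _ (minSum w))
... | _ ∷ _ | _ = refl

∈ᵇ-reach : ∀ w z → z ∈ᵇ L⁺.toList (reach w) ≡ profileℤ (anyConsecutive w) (width w) (z - minSum w)
∈ᵇ-reach w z = trans (cong (z ∈ᵇ_) (toList-reach w)) (∈ᵇ-reachL w z)

minW≡minSum : ∀ w → minW w ≡ minSum w
minW≡minSum w = foldr₁-⊓-≡ (reach w) (minSum w)
  (subst T (sym (∈ᵇ-reach w (minSum w))) (profileℤ-at-min _ _ (minSum w)))
  (λ z p → proj₁ (profileℤ-bounds _ _ (minSum w) z (subst T (∈ᵇ-reach w z) p)))

maxW≡maxSum : ∀ w → maxW w ≡ maxSum w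
maxW≡maxSum w = foldr₁-⊔-≡ (reach w) (maxSum w)
  (subst T (sym (∈ᵇ-reach w (maxSum w))) (profileℤ-at-max _ _ (minSum w) (admissible w)))
  (λ z p → proj₂ (profileℤ-bounds _ _ (minSum w) z (subst T (∈ᵇ-reach w z) p)))

normW≡width : ∀ w → normW w ≡ width w
normW≡width w rewrite maxW≡maxSum w | minW≡minSum w | i+j-i≡j (minSum w) (+ width w) = refl

isTypeI≡anyConsecutive : ∀ w → isTypeI w ≡ anyConsecutive w
isTypeI≡anyConsecutive w =
  trans (cong₂ (λ m D → (L ≈ᵇ interval m D) ∧ (1 ≤ᵇ D)) (minW≡minSum w) (normW≡width w))
        (typeI-of-profile L _ _ (minSum w) (∈ᵇ-reach w) (admissible w))
  where L = L⁺.toList (reach w)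

isTypeII≡not-anyConsecutive : ∀ w → isTypeII w ≡ not (anyConsecutive w)
isTypeII≡not-anyConsecutive w =
  trans (cong₂ (λ m D → L ≈ᵇ evenInterval m (D ℕ./ 2)) (minW≡minSum w) (normW≡width w))
        (typeII-of-profile L _ _ (minSum w) (∈ᵇ-reach w) (admissible w))
  where L = L⁺.toList (reach w)

-- Counting walks by length, minimum and maximum

count : {A : Set} → (A → Bool) → List A → ℕ
count p xs = length (filterᵇ p xs)

count-cong : ∀ {A : Set} {p q : A → Bool} → (∀ x → p x ≡ q x) → ∀ xs → count p xs ≡ count q xs
count-cong {p = p} {q} p≗q []       = refl
count-cong {p = p} {q} p≗q (x ∷ xs) with p x | q x | p≗q x
... | true  | .true  | refl = cong suc (count-cong p≗q xs)
... | false | .false | refl = count-cong p≗q xs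

count-++ : ∀ {A : Set} (p : A → Bool) xs ys → count p (xs ++ ys) ≡ count p xs ℕ.+ count p ys
count-++ p xs ys = trans (cong length (LP.filter-++ (T? ∘ p) xs ys)) (LP.length-++ (filterᵇ p xs))

count-map : ∀ {A B : Set} (p : B → Bool) (f : A → B) xs → count p (map f xs) ≡ count (p ∘ f) xs
count-map p f []       = refl
count-map p f (x ∷ xs) with p (f x)
... | true  = cong suc (count-map p f xs)
... | false = count-map p f xs

count-guard : ∀ {A : Set} b (p : A → Bool) xs →
              count (λ x → b ∧ p x) xs ≡ (if b then count p xs else 0)
count-guard true  p xs = refl
count-guard false p []       = refl
count-guard false p (x ∷ xs) = count-guard false p xs

count-partition : ∀ {A : Set} (p q : A → Bool) xs →
                  count (λ x → p x ∧ q x) xs ℕ.+ count (λ x → not (p x) ∧ q x) xs ≡ count q xs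
count-partition p q []       = refl
count-partition p q (x ∷ xs) with p x | q x
... | true  | true  = cong suc (count-partition p q xs)
... | true  | false = count-partition p q xs
... | false | true  = trans (ℕP.+-suc _ _) (cong suc (count-partition p q xs))
... | false | false = count-partition p q xs

count-concatMap-∷ : ∀ (p : Walk → Bool) (ss : List Step) ws →
                    count p (concatMap (λ s → map (s ∷_) ws) ss)
                    ≡ sum (map (λ s → count (p ∘ (s ∷_)) ws) ss)
count-concatMap-∷ p []       ws = refl
count-concatMap-∷ p (s ∷ ss) ws = trans (count-++ p (map (s ∷_) ws) _)
  (cong₂ ℕ._+_ (count-map p (s ∷_) ws) (count-concatMap-∷ p ss ws))

count-singleton : ∀ {A : Set} (p : A → Bool) x → count p (x ∷ []) ≡ (if p x then 1 else 0)
count-singleton p x with p x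
... | true  = refl
... | false = refl

atMinMax : ℤ → ℤ → Walk → Bool
atMinMax a b w = ⌊ minSum w ℤ.≟ a ⌋ ∧ ⌊ maxSum w ℤ.≟ b ⌋

countAt : (Walk → Bool) → ℕ → ℤ → ℤ → ℕ
countAt p n a b = count (λ w → p w ∧ atMinMax a b w) (walksOfLength n)

maxSum-∷ : ∀ s w → maxSum (s ∷ w) ≡ maxStep s ℤ.+ maxSum w
maxSum-∷ s w = regroup (minStep s) (minSum w) (+ widthStep s) (+ width w)
  where
  regroup : ∀ m m′ d d′ → (m ℤ.+ m′) ℤ.+ (d ℤ.+ d′) ≡ (m ℤ.+ d) ℤ.+ (m′ ℤ.+ d′)
  regroup = solve-∀

atMinMax-∷ : ∀ a b s w → atMinMax a b (s ∷ w) ≡ atMinMax (a - minStep s) (b - maxStep s) w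
atMinMax-∷ a b s w =
  cong₂ _∧_ (≟-+ˡ (minStep s) (minSum w) a)
            (trans (cong (λ m → ⌊ m ℤ.≟ b ⌋) (maxSum-∷ s w)) (≟-+ˡ (maxStep s) (maxSum w) b))

stepCount : (Step → Bool) → (Walk → Bool) → ℕ → ℤ → ℤ → Step → ℕ
stepCount allowed p n a b s = if allowed s then countAt p n (a - minStep s) (b - maxStep s) else 0

countAt-suc : ∀ (allowed : Step → Bool) (p : Walk → Bool) → (∀ s w → p (s ∷ w) ≡ allowed s ∧ p w) →
              ∀ n a b → countAt p (suc n) a b ≡ sum (map (stepCount allowed p n a b) allSteps)
countAt-suc allowed p p-∷ n a b =
  trans (count-concatMap-∷ _ allSteps (walksOfLength n)) (cong sum (LP.map-cong peel allSteps))
  where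
  peel : ∀ s → count (λ w → p (s ∷ w) ∧ atMinMax a b (s ∷ w)) (walksOfLength n)
               ≡ stepCount allowed p n a b s
  peel s = trans (count-cong (λ w → trans (cong₂ _∧_ (p-∷ s w) (atMinMax-∷ a b s w))
                                          (∧-assoc (allowed s) (p w) _))
                             (walksOfLength n))
                 (count-guard (allowed s) _ (walksOfLength n))

-- Series and polynomial multipliers

Term : Set
Term = ℕ × ℤ × ℤ × ℤ

infixr 7 _·_
_·_ : Term → Series → Series
((k , c , d , q) · F) n a b = if k ≤ᵇ n then q ℤ.* F (n ∸ k) (a - c) (b - d) else + 0

_*ₜ_ : Term → Term → Term
(k , c , d , q) *ₜ (k′ , c′ , d′ , q′) = (k ℕ.+ k′ , c ℤ.+ c′ , d ℤ.+ d′ , q ℤ.* q′)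

infix 4 _≐_
_≐_ : Series → Series → Set
F ≐ G = ∀ n a b → F n a b ≡ G n a b

infixl 6 _⊕_
_⊕_ : Series → Series → Series
(F ⊕ G) n a b = F n a b ℤ.+ G n a b

0ˢ : Series
0ˢ n a b = + 0

·-⊕ : ∀ t F G → t · (F ⊕ G) ≐ t · F ⊕ t · G
·-⊕ (k , c , d , q) F G n a b with k ≤ᵇ n
... | true  = ℤP.*-distribˡ-+ q _ _
... | false = refl

·-0ˢ : ∀ t → t · 0ˢ ≐ 0ˢ
·-0ˢ (k , c , d , q) n a b with k ≤ᵇ n
... | true  = ℤP.*-zeroʳ q
... | false = refl

·-· : ∀ t t′ F → t · t′ · F ≐ (t *ₜ t′) · F
·-· (k , c , d , q) (k′ , c′ , d′ , q′) F n a b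
  with k ≤ᵇ n | ℕP.≤ᵇ-reflects-≤ k n
     | k′ ≤ᵇ n ∸ k | ℕP.≤ᵇ-reflects-≤ k′ (n ∸ k)
     | k ℕ.+ k′ ≤ᵇ n | ℕP.≤ᵇ-reflects-≤ (k ℕ.+ k′) n
... | false | _       | _     | _        | false | _        = refl
... | false | ofⁿ k≰n | _     | _        | true  | ofʸ kk′≤n = ⊥-elim (k≰n (ℕP.m+n≤o⇒m≤o k kk′≤n))
... | true  | _       | false | _        | false | _        = ℤP.*-zeroʳ q
... | true  | _       | false | ofⁿ k′≰ | true  | ofʸ kk′≤n =
  ⊥-elim (k′≰ (ℕP.m+n≤o⇒m≤o∸n k′ (subst (ℕ._≤ n) (ℕP.+-comm k k′) kk′≤n)))
... | true  | ofʸ k≤n | true  | ofʸ k′≤ | false | ofⁿ kk′≰ =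
  ⊥-elim (kk′≰ (subst (ℕ._≤ n) (ℕP.+-comm k′ k) (ℕP.m≤o∸n⇒m+n≤o k′ k≤n k′≤)))
... | true  | _       | true  | _        | true  | _
  rewrite ℕP.∸-+-assoc n k k′ | i-j-k≡i-[j+k] a c c′ | i-j-k≡i-[j+k] b d d′ = sym (ℤP.*-assoc q q′ _)

*ₜ-comm : ∀ t t′ → t *ₜ t′ ≡ t′ *ₜ t
*ₜ-comm (k , c , d , q) (k′ , c′ , d′ , q′)
  rewrite ℕP.+-comm k k′ | ℤP.+-comm c c′ | ℤP.+-comm d d′ | ℤP.*-comm q q′ = refl

·-comm : ∀ t t′ F → t · t′ · F ≐ t′ · t · F
·-comm t t′ F n a b =
  trans (·-· t t′ F n a b) (trans (cong (λ s → (s · F) n a b) (*ₜ-comm t t′)) (sym (·-· t′ t F n a b)))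

⊛-cong : ∀ Q {F G} → F ≐ G → Q ⊛ F ≐ Q ⊛ G
⊛-cong []      F≐G n a b = refl
⊛-cong (t ∷ Q) F≐G n a b =
  cong₂ ℤ._+_ (·-cong t F≐G n a b) (⊛-cong Q F≐G n a b)
  where
  ·-cong : ∀ t {F G} → F ≐ G → t · F ≐ t · G
  ·-cong (k , c , d , q) F≐G n a b = cong (λ x → if k ≤ᵇ n then q ℤ.* x else + 0) (F≐G _ _ _)

⊛-⊕ : ∀ Q F G → Q ⊛ (F ⊕ G) ≐ Q ⊛ F ⊕ Q ⊛ G
⊛-⊕ []      F G n a b = refl
⊛-⊕ (t ∷ Q) F G n a b =
  trans (cong₂ ℤ._+_ (·-⊕ t F G n a b) (⊛-⊕ Q F G n a b))
        (middle-swap ((t · F) n a b) ((t · G) n a b) ((Q ⊛ F) n a b) ((Q ⊛ G) n a b))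
  where
  middle-swap : ∀ x y z w → (x ℤ.+ y) ℤ.+ (z ℤ.+ w) ≡ (x ℤ.+ z) ℤ.+ (y ℤ.+ w)
  middle-swap = solve-∀

⊛-0ˢ : ∀ Q → Q ⊛ 0ˢ ≐ 0ˢ
⊛-0ˢ []      n a b = refl
⊛-0ˢ (t ∷ Q) n a b = cong₂ ℤ._+_ (·-0ˢ t n a b) (⊛-0ˢ Q n a b)

⊛-++ : ∀ Q Q′ F → (Q ++ Q′) ⊛ F ≐ Q ⊛ F ⊕ Q′ ⊛ F
⊛-++ []      Q′ F n a b = sym (ℤP.+-identityˡ _)
⊛-++ (t ∷ Q) Q′ F n a b =
  trans (cong (λ x → (t · F) n a b ℤ.+ x) (⊛-++ Q Q′ F n a b)) (sym (ℤP.+-assoc ((t · F) n a b) _ _))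

·-⊛ : ∀ t Q F → t · (Q ⊛ F) ≐ Q ⊛ (t · F)
·-⊛ t []       F n a b = ·-0ˢ t n a b
·-⊛ t (t′ ∷ Q) F n a b =
  trans (·-⊕ t (t′ · F) (Q ⊛ F) n a b) (cong₂ ℤ._+_ (·-comm t t′ F n a b) (·-⊛ t Q F n a b))

⊛-comm : ∀ Q Q′ F → Q ⊛ (Q′ ⊛ F) ≐ Q′ ⊛ (Q ⊛ F)
⊛-comm []      Q′ F n a b = sym (⊛-0ˢ Q′ n a b)
⊛-comm (t ∷ Q) Q′ F n a b =
  trans (cong₂ ℤ._+_ (·-⊛ t Q′ F n a b) (⊛-comm Q Q′ F n a b)) (sym (⊛-⊕ Q′ (t · F) (Q ⊛ F) n a b))

_*ᴾ_ : Poly → Poly → Poly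
Q *ᴾ Q′ = concatMap (λ t → map (t *ₜ_) Q′) Q

map-*ₜ-⊛ : ∀ t Q F → map (t *ₜ_) Q ⊛ F ≐ t · (Q ⊛ F)
map-*ₜ-⊛ t []       F n a b = sym (·-0ˢ t n a b)
map-*ₜ-⊛ t (t′ ∷ Q) F n a b =
  trans (cong₂ ℤ._+_ (sym (·-· t t′ F n a b)) (map-*ₜ-⊛ t Q F n a b))
        (sym (·-⊕ t (t′ · F) (Q ⊛ F) n a b))

*ᴾ-⊛ : ∀ Q Q′ F → (Q *ᴾ Q′) ⊛ F ≐ Q ⊛ (Q′ ⊛ F)
*ᴾ-⊛ []      Q′ F n a b = refl
*ᴾ-⊛ (t ∷ Q) Q′ F n a b =
  trans (⊛-++ (map (t *ₜ_) Q′) (Q *ᴾ Q′) F n a b)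
        (cong₂ ℤ._+_ (map-*ₜ-⊛ t Q′ F n a b) (*ᴾ-⊛ Q Q′ F n a b))

one : Poly
one = (0 , + 0 , + 0 , + 1) ∷ []

·-one : ∀ t → t · coeff one ≐ coeff (t ∷ [])
·-one (k , c , d , q) n a b with k ≤ᵇ n | ℕP.≤ᵇ-reflects-≤ k n
... | true  | ofʸ k≤n =
  trans (cong (λ B → q ℤ.* ((if B then + 1 else + 0) ℤ.+ + 0))
              (cong₂ _∧_ (zero≟∸ k≤n) (cong₂ _∧_ (zero≟- c a) (zero≟- d b))))
        (scale (⌊ k ℕ.≟ n ⌋ ∧ ⌊ c ℤ.≟ a ⌋ ∧ ⌊ d ℤ.≟ b ⌋))
  where
  zero≟∸ : k ℕ.≤ n → ⌊ 0 ℕ.≟ n ∸ k ⌋ ≡ ⌊ k ℕ.≟ n ⌋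
  zero≟∸ k≤n = ⌊⌋-⇔ (λ 0≡n∸k → ℕP.≤-antisym k≤n (ℕP.m∸n≡0⇒m≤n (sym 0≡n∸k)))
                    (λ { refl → sym (ℕP.n∸n≡0 k) }) _ _
  zero≟- : ∀ c a → ⌊ + 0 ℤ.≟ a - c ⌋ ≡ ⌊ c ℤ.≟ a ⌋
  zero≟- c a = ⌊⌋-⇔ (λ 0≡a-c → sym (ℤP.i-j≡0⇒i≡j a c (sym 0≡a-c)))
                    (λ c≡a → sym (ℤP.i≡j⇒i-j≡0 (sym c≡a))) _ _
  scale : ∀ B → q ℤ.* ((if B then + 1 else + 0) ℤ.+ + 0) ≡ (if B then q else + 0) ℤ.+ + 0
  scale true  = trans (ℤP.*-identityʳ q) (sym (ℤP.+-identityʳ q))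
  scale false = ℤP.*-zeroʳ q
... | false | ofⁿ k≰n with k ℕ.≟ n
...   | yes refl = ⊥-elim (k≰n ℕP.≤-refl)
...   | no _     = refl

⊛-one : ∀ Q → Q ⊛ coeff one ≐ coeff Q
⊛-one []      n a b = refl
⊛-one (t@(k , c , d , q) ∷ Q) n a b =
  trans (cong₂ ℤ._+_ (·-one t n a b) (⊛-one Q n a b))
        (cong (ℤ._+ coeff Q n a b)
              (ℤP.+-identityʳ (if ⌊ k ℕ.≟ n ⌋ ∧ ⌊ c ℤ.≟ a ⌋ ∧ ⌊ d ℤ.≟ b ⌋ then q else + 0)))

negᴾ : Poly → Poly
negᴾ = map (λ (k , c , d , q) → (k , c , d , ℤ.- q))

coeff-negᴾ : ∀ P n a b → coeff (negᴾ P) n a b ≡ ℤ.- coeff P n a b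
coeff-negᴾ []                  n a b = refl
coeff-negᴾ ((k , c , d , q) ∷ P) n a b with ⌊ k ℕ.≟ n ⌋ ∧ ⌊ c ℤ.≟ a ⌋ ∧ ⌊ d ℤ.≟ b ⌋
... | true  = trans (cong (λ x → ℤ.- q ℤ.+ x) (coeff-negᴾ P n a b)) (sym (ℤP.neg-distrib-+ q _))
... | false = trans (ℤP.+-identityˡ _) (trans (coeff-negᴾ P n a b) (cong ℤ.-_ (sym (ℤP.+-identityˡ _))))

coeff-++ : ∀ P P′ → coeff (P ++ P′) ≐ coeff P ⊕ coeff P′
coeff-++ []      P′ n a b = sym (ℤP.+-identityˡ _)
coeff-++ ((k , c , d , q) ∷ P) P′ n a b =
  trans (cong (λ x → term ℤ.+ x) (coeff-++ P P′ n a b)) (sym (ℤP.+-assoc term _ _))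
  where
  term : ℤ
  term = if ⌊ k ℕ.≟ n ⌋ ∧ ⌊ c ℤ.≟ a ⌋ ∧ ⌊ d ℤ.≟ b ⌋ then q else + 0

-- The kernel equations

walkSeries : (Walk → Bool) → Series
walkSeries p n a b = + countAt p n a b

weight : Bool → ℤ
weight b = if b then + 1 else + 0

stepTerm : (Step → Bool) → Step → Term
stepTerm allowed s = (1 , minStep s , maxStep s , ℤ.- weight (allowed s))

-- 1 − t Σ_{allowed s} x^{min s} y^{max s}; a step that is not allowed gets coefficient 0.
kernel : (Step → Bool) → Poly
kernel allowed = one ++ map (stepTerm allowed) allSteps

stepTerms-⊛ : ∀ allowed p ss m a b →
  (map (stepTerm allowed) ss ⊛ walkSeries p) (suc m) a b
  ≡ ℤ.- + sum (map (stepCount allowed p m a b) ss)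
stepTerms-⊛ allowed p []       m a b = refl
stepTerms-⊛ allowed p (s ∷ ss) m a b with allowed s
... | true  = trans (cong₂ ℤ._+_ (ℤP.-1*i≡-i (walkSeries p m (a - minStep s) (b - maxStep s)))
                                 (stepTerms-⊛ allowed p ss m a b))
                    (sym (ℤP.neg-distrib-+ (walkSeries p m (a - minStep s) (b - maxStep s))
                                           (+ sum (map (stepCount allowed p m a b) ss))))
... | false = trans (ℤP.+-identityˡ _) (stepTerms-⊛ allowed p ss m a b)

kernel-⊛-walkSeries : ∀ allowed p → p [] ≡ true → (∀ s w → p (s ∷ w) ≡ allowed s ∧ p w) →
                      kernel allowed ⊛ walkSeries p ≐ coeff one
kernel-⊛-walkSeries allowed p p[] p-∷ zero a b = cong (ℤ._+ + 0) (begin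
  + 1 ℤ.* walkSeries p 0 a′ b′                          ≡⟨ ℤP.*-identityˡ _ ⟩
  + count φ ([] ∷ [])                                   ≡⟨ cong +_ (count-singleton φ []) ⟩
  + (if φ [] then 1 else 0)                             ≡⟨ indicator (φ []) _ empty ⟩
  (if ⌊ + 0 ℤ.≟ a ⌋ ∧ ⌊ + 0 ℤ.≟ b ⌋ then + 1 else + 0)  ∎)
  where
  open ≡-Reasoning
  a′ b′ : ℤ
  a′ = a - + 0
  b′ = b - + 0
  φ : Walk → Bool
  φ w = p w ∧ atMinMax a′ b′ w
  empty : φ [] ≡ ⌊ + 0 ℤ.≟ a ⌋ ∧ ⌊ + 0 ℤ.≟ b ⌋
  empty = cong₂ _∧_ p[] (cong₂ (λ a b → ⌊ + 0 ℤ.≟ a ⌋ ∧ ⌊ + 0 ℤ.≟ b ⌋)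
                               (ℤP.+-identityʳ a) (ℤP.+-identityʳ b))
  indicator : ∀ B C → B ≡ C → + (if B then 1 else 0) ≡ (if C then + 1 else + 0)
  indicator true  _ refl = refl
  indicator false _ refl = refl
kernel-⊛-walkSeries allowed p p[] p-∷ (suc m) a b = begin
  + 1 ℤ.* walkSeries p (suc m) (a - + 0) (b - + 0) ℤ.+ (steps ⊛ walkSeries p) (suc m) a b
    ≡⟨ cong₂ ℤ._+_ (trans (ℤP.*-identityˡ _) (cong₂ (walkSeries p (suc m)) (ℤP.+-identityʳ a)
                                                                          (ℤP.+-identityʳ b)))
                   (stepTerms-⊛ allowed p allSteps m a b) ⟩
  + countAt p (suc m) a b ℤ.- + S  ≡⟨ cong (λ N → + N ℤ.- + S) (countAt-suc allowed p p-∷ m a b) ⟩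
  + S ℤ.- + S                      ≡⟨ ℤP.+-inverseʳ (+ S) ⟩
  + 0                              ∎
  where
  open ≡-Reasoning
  steps = map (stepTerm allowed) allSteps
  S = sum (map (stepCount allowed p m a b) allSteps)

countWalks≡countAt : ∀ P P′ → (∀ w → P w ≡ P′ w) → ∀ n a b → countWalks P n a b ≡ countAt P′ n a b
countWalks≡countAt P P′ P≗P′ n a b = count-cong
  (λ w → cong₂ _∧_ (P≗P′ w) (cong₂ (λ m M → ⌊ m ℤ.≟ a ⌋ ∧ ⌊ M ℤ.≟ b ⌋) (minW≡minSum w) (maxW≡maxSum w)))
  (walksOfLength n)

M-I≐ : M-I ≐ walkSeries anyConsecutive
M-I≐ n a b = cong +_ (countWalks≡countAt isTypeI anyConsecutive isTypeI≡anyConsecutive n a b)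

M-II≐ : M-II ≐ walkSeries (not ∘ anyConsecutive)
M-II≐ n a b =
  cong +_ (countWalks≡countAt isTypeII (not ∘ anyConsecutive) isTypeII≡not-anyConsecutive n a b)

M≐ : M ≐ walkSeries (λ _ → true)
M≐ n a b = trans (cong₂ ℤ._+_ (M-I≐ n a b) (M-II≐ n a b))
                 (cong +_ (count-partition anyConsecutive (atMinMax a b) (walksOfLength n)))

Q₁ Q₂ : Poly
Q₁ = kernel (λ _ → true)
Q₂ = kernel (not ∘ hasConsecutive)

Q₁⊛M : Q₁ ⊛ M ≐ coeff one
Q₁⊛M n a b = trans (⊛-cong Q₁ M≐ n a b)
  (kernel-⊛-walkSeries (λ _ → true) (λ _ → true) refl (λ _ _ → refl) n a b)

Q₂⊛M-II : Q₂ ⊛ M-II ≐ coeff one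
Q₂⊛M-II n a b = trans (⊛-cong Q₂ M-II≐ n a b)
  (kernel-⊛-walkSeries (not ∘ hasConsecutive) (not ∘ anyConsecutive) refl
                       (λ s w → not-∨ (hasConsecutive s) (anyConsecutive w)) n a b)

Q₁Q₂⊛M : (Q₁ *ᴾ Q₂) ⊛ M ≐ coeff Q₂
Q₁Q₂⊛M n a b = begin
  ((Q₁ *ᴾ Q₂) ⊛ M) n a b  ≡⟨ *ᴾ-⊛ Q₁ Q₂ M n a b ⟩
  (Q₁ ⊛ (Q₂ ⊛ M)) n a b   ≡⟨ ⊛-comm Q₁ Q₂ M n a b ⟩
  (Q₂ ⊛ (Q₁ ⊛ M)) n a b   ≡⟨ ⊛-cong Q₂ Q₁⊛M n a b ⟩
  (Q₂ ⊛ coeff one) n a b  ≡⟨ ⊛-one Q₂ n a b ⟩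
  coeff Q₂ n a b          ∎
  where open ≡-Reasoning

Q₁Q₂⊛M-II : (Q₁ *ᴾ Q₂) ⊛ M-II ≐ coeff Q₁
Q₁Q₂⊛M-II n a b = begin
  ((Q₁ *ᴾ Q₂) ⊛ M-II) n a b  ≡⟨ *ᴾ-⊛ Q₁ Q₂ M-II n a b ⟩
  (Q₁ ⊛ (Q₂ ⊛ M-II)) n a b   ≡⟨ ⊛-cong Q₁ Q₂⊛M-II n a b ⟩
  (Q₁ ⊛ coeff one) n a b     ≡⟨ ⊛-one Q₁ n a b ⟩
  coeff Q₁ n a b             ∎
  where open ≡-Reasoning

Q₁Q₂⊛M-I : (Q₁ *ᴾ Q₂) ⊛ M-I ≐ coeff (Q₂ ++ negᴾ Q₁)
Q₁Q₂⊛M-I n a b = begin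
  x                                         ≡⟨ cancel x y ⟩
  x ℤ.+ y ℤ.- y
    ≡⟨ cong₂ ℤ._-_ (trans (sym (⊛-⊕ Q M-I M-II n a b)) (Q₁Q₂⊛M n a b)) (Q₁Q₂⊛M-II n a b) ⟩
  coeff Q₂ n a b ℤ.- coeff Q₁ n a b         ≡⟨ cong (λ z → coeff Q₂ n a b ℤ.+ z) (coeff-negᴾ Q₁ n a b) ⟨
  coeff Q₂ n a b ℤ.+ coeff (negᴾ Q₁) n a b  ≡⟨ coeff-++ Q₂ (negᴾ Q₁) n a b ⟨
  coeff (Q₂ ++ negᴾ Q₁) n a b               ∎
  where
  open ≡-Reasoning
  Q = Q₁ *ᴾ Q₂
  x = (Q ⊛ M-I) n a b
  y = (Q ⊛ M-II) n a b
  cancel : ∀ x y → x ≡ x ℤ.+ y ℤ.- y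
  cancel = solve-∀

theorem3p3 : IsRational M-I × IsRational M-II × IsRational M
theorem3p3 =
  (Q₂ ++ negᴾ Q₁ , Q₁ *ᴾ Q₂ , (0 , + 0 , + 0 , λ ()) , Q₁Q₂⊛M-I) ,
  (one           , Q₂       , (0 , + 0 , + 0 , λ ()) , Q₂⊛M-II) ,
  (one           , Q₁       , (0 , + 0 , + 0 , λ ()) , Q₁⊛M)
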